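{- Let $m\ge1$. For every $\nu=(\nu_1,\dots,\nu_m)\in\mathcal P_m(m)$, $$u_{m,m}(\nu)=m\,(-1)^{\ell(\nu)-1}\,(\ell(\nu)-1)!\,(m-\ell(\nu))!.$$
   Context: $\mathcal P_m(m)$ is the set of $\nu\in\mathbb{Z}_{\ge0}^m$ with $\nu_1+\cdots+\nu_m=m$; $\ell(\nu)$ is the number of positive entries of $\nu$. $\zeta_m$ is a primitive $m$-th root of unity, and $u_{m,m}(\nu)=\sum_{\sigma\in S_m}\zeta_m^{\sigma(1)\nu_1+\cdots+\sigma(m)\nu_m}$. -}

module Defs where

open import Level using (Level)
open import Data.Nat using (ℕ; zero; suc; _<?_)
import Data.Nat as ℕ
open import Data.Fin using (Fin; zero; suc; toℕ; _≟_)
open import Data.Fin.Properties using (all?)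
open import Data.List using (List; []; _∷_; map; concatMap; filter; foldr; length; allFin)
open import Data.Nat.ListAction using (sum)
open import Data.Sum using (_⊎_)
open import Data.Product using (_×_)
open import Relation.Binary.PropositionalEquality using (_≡_)
open import Relation.Nullary using (¬_; Dec)
open import Relation.Nullary.Decidable using (_→-dec_)
open import Algebra.Bundles using (CommutativeRing)

NoZeroDivisors : ∀ {c ℓ} → CommutativeRing c ℓ → Set _
NoZeroDivisors R = ∀ x y → x * y ≈ 0# → (x ≈ 0#) ⊎ (y ≈ 0#)
  where open CommutativeRing R

module _ {c ℓ} (R : CommutativeRing c ℓ) where
  open CommutativeRing R

  pow : Carrier → ℕ → Carrier
  pow x zero    = 1#
  pow x (suc n) = x * pow x n

  natCast : ℕ → Carrier
  natCast zero    = 0#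
  natCast (suc n) = 1# + natCast n

  rsum : List Carrier → Carrier
  rsum = foldr _+_ 0#

  IsPrimitiveRoot : ℕ → Carrier → Set ℓ
  IsPrimitiveRoot m ζ = (pow ζ m ≈ 1#) × (∀ k → 0 ℕ.< k → k ℕ.< m → ¬ (pow ζ k ≈ 1#))

allFuns : (n k : ℕ) → List (Fin n → Fin k)
allFuns zero    k = (λ ()) ∷ []
allFuns (suc n) k = concatMap (λ f → map (λ j → extend j f) (allFin k)) (allFuns n k)
  where
  extend : Fin k → (Fin n → Fin k) → Fin (suc n) → Fin k
  extend j f zero    = j
  extend j f (suc i) = f i

Injective : ∀ {n} → (Fin n → Fin n) → Set
Injective {n} σ = ∀ i j → σ i ≡ σ j → i ≡ j

injective? : ∀ {n} (σ : Fin n → Fin n) → Dec (Injective σ)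
injective? σ = all? (λ i → all? (λ j → (σ i ≟ σ j) →-dec (i ≟ j)))

-- the symmetric group S_n, enumerated as the list of all injective
-- (equivalently bijective) maps Fin n → Fin n
Sym : (n : ℕ) → List (Fin n → Fin n)
Sym n = filter injective? (allFuns n n)

-- ν ∈ P_m(m): compositions ν : Fin m → ℕ with ν₁ + … + ν_m = m
total : ∀ {m} → (Fin m → ℕ) → ℕ
total {m} ν = sum (map ν (allFin m))

ell : ∀ {m} → (Fin m → ℕ) → ℕ
ell {m} ν = length (filter (λ i → 0 <? ν i) (allFin m))

-- u_{m,m}(ν) = Σ_{σ ∈ S_m} ζ^{σ(1)ν₁ + … + σ(m)ν_m}
-- (indices are 1-based: the value σ(i) ∈ {1,…,m} is toℕ (σ i) + 1)
u : ∀ {c ℓ} (R : CommutativeRing c ℓ) (m : ℕ) → CommutativeRing.Carrier R →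
    (Fin m → ℕ) → CommutativeRing.Carrier R
u R m ζ ν = rsum R (map (λ σ → pow R ζ (sum (map (λ i → suc (toℕ (σ i)) ℕ.* ν i) (allFin m)))) (Sym m))

module Submission where

open import Defs
open import Data.Nat using (ℕ; _≤_; _∸_; _!)
open import Data.Fin using (Fin)
open import Relation.Binary.PropositionalEquality using (_≡_)
open import Algebra.Bundles using (CommutativeRing)

open import Data.Nat using (zero; suc; _<_)
import Data.Nat as ℕ
import Data.Nat.Properties as ℕ
open import Data.Fin using (zero; suc; toℕ; _≟_)
open import Data.Nat.ListAction as List using ()
open import Data.List using (List; []; _∷_; _++_; map; concatMap; filter; foldr; tabulate; allFin)
open import Data.List.Properties using (map-tabulate)
open import Data.Vec.Functional using (Vector; tail)
open import Data.Vec.Functional.Properties using (updateAt-id-local)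
import Data.Vec.Functional as Vector
open import Function using (_∘_)
open import Data.Bool using (if_then_else_)
open import Data.Empty using (⊥-elim)
open import Data.Sum using (_⊎_; inj₁; inj₂)
open import Data.Product using (_×_; _,_; proj₁; proj₂; ∃; Σ-syntax)
open import Data.Fin.Properties using (all?; any?; suc-injective; 0≢1+n)
open import Relation.Nullary using (¬_; Dec; does; yes; no)
open import Relation.Nullary.Decidable using (_→-dec_; ¬?)
open import Relation.Binary.PropositionalEquality as ≡ using (_≗_; module ≡-Reasoning)
import Algebra.Properties.CommutativeMonoid.Sum ℕ.+-0-commutativeMonoid as ℕ∑

-- For w : Fin n → ℕ let F(w) = Σ ζ^(Σᵢ f(i) wᵢ) over the injections
-- f : Fin n → Fin m, values counted from 0; then u_{m,m}(ν) = ζ^(Σν) F(ν) = F(ν).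
-- Splitting an injection into its value j at 0 and its restriction f, the
-- admissible j are all of Fin m minus the image of f; writing w = (w₀, w′) this
-- gives the deletion recursion F(w) + Σᵢ F(w′ + w₀ eᵢ) = G(w₀) F(w′), where
-- G(a) = Σ_{j<m} ζ^(ja). For a primitive m-th root of unity in a domain,
-- G(a) = m if a ∈ {0, m} and G(a) = 0 if 0 < a < m. By induction on n ≤ m, for
-- Σw = m with l positive and z zero entries, F(w) = m (-1)^(l-1) (l-1)! · (m-l)↓z
-- with the falling factorial ↓; each of the three cases for w₀ reduces to
-- Pascal's rule for ↓. For n = m one has z = m - l and (m-l)↓(m-l) = (m-l)!.

module Falling where
  open import Data.Nat using (pred; _+_; _*_; _≤?_; s≤s)
  import Algebra.Properties.CommutativeSemigroup ℕ.*-commutativeSemigroup as ℕ*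

  -- k ↓ z = k (k-1) ⋯ (k-z+1), the number of injections of a z-set into a
  -- k-set; it vanishes as soon as z > k.
  _↓_ : ℕ → ℕ → ℕ
  k ↓ zero  = 1
  k ↓ suc z = k * (pred k ↓ z)

  ↓-self : ∀ k → k ↓ k ≡ k !
  ↓-self zero    = ≡.refl
  ↓-self (suc k) = ≡.cong (suc k *_) (↓-self k)

  ↓-vanish : ∀ {k z} → k < z → k ↓ z ≡ 0
  ↓-vanish {zero}  {suc z} _         = ≡.refl
  ↓-vanish {suc k} {suc z} (s≤s k<z) = ≡.trans (≡.cong (suc k *_) (↓-vanish k<z)) (ℕ.*-zeroʳ (suc k))

  ↓-suc : ∀ k z → k ↓ suc z ≡ (k ∸ z) * (k ↓ z)
  ↓-suc k       zero    = ≡.refl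
  ↓-suc zero    (suc z) = ≡.refl
  ↓-suc (suc k) (suc z) = begin
    suc k * (k ↓ suc z)          ≡⟨ ≡.cong (suc k *_) (↓-suc k z) ⟩
    suc k * ((k ∸ z) * (k ↓ z))  ≡⟨ ℕ*.x∙yz≈y∙xz (suc k) (k ∸ z) (k ↓ z) ⟩
    (k ∸ z) * (suc k * (k ↓ z))  ∎
    where open ≡-Reasoning

  ↓-pascal : ∀ k z → suc k ↓ z ≡ k ↓ z + z * (k ↓ (z ∸ 1))
  ↓-pascal k zero    = ≡.refl
  ↓-pascal k (suc z) with z ≤? k
  ... | yes z≤k = begin
    suc k * (k ↓ z)                        ≡⟨ ≡.cong (_* (k ↓ z)) k+1≡[k-z]+[z+1] ⟩
    ((k ∸ z) + suc z) * (k ↓ z)            ≡⟨ ℕ.*-distribʳ-+ (k ↓ z) (k ∸ z) (suc z) ⟩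
    (k ∸ z) * (k ↓ z) + suc z * (k ↓ z)    ≡⟨ ≡.cong (_+ suc z * (k ↓ z)) (↓-suc k z) ⟨
    k ↓ suc z + suc z * (k ↓ z)            ∎
    where
    open ≡-Reasoning
    k+1≡[k-z]+[z+1] : suc k ≡ (k ∸ z) + suc z
    k+1≡[k-z]+[z+1] = ≡.trans (≡.cong suc (≡.sym (ℕ.m∸n+n≡m z≤k))) (≡.sym (ℕ.+-suc (k ∸ z) z))
  ... | no z≰k = begin
    suc k * (k ↓ z)                  ≡⟨ ≡.cong (suc k *_) k↓z≡0 ⟩
    suc k * 0                        ≡⟨ ℕ.*-zeroʳ (suc k) ⟩
    0                                ≡⟨ ℕ.*-zeroʳ (suc z) ⟨
    0 + suc z * 0                    ≡⟨ ≡.cong₂ _+_ (↓-vanish (ℕ.m<n⇒m<1+n k<z)) (≡.cong (suc z *_) k↓z≡0) ⟨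
    k ↓ suc z + suc z * (k ↓ z)      ∎
    where
    open ≡-Reasoning
    k<z = ℕ.≰⇒> z≰k
    k↓z≡0 = ↓-vanish k<z

open Falling

module Counting where
  open import Data.Nat using (_+_; _*_; _<?_)
  open import Data.List using (length)
  open import Data.Vec.Functional using (updateAt)
  import Algebra.Properties.CommutativeSemigroup ℕ.+-commutativeSemigroup as ℕ+

  isPos : ℕ → ℕ
  isPos zero    = 0
  isPos (suc _) = 1

  isZero : ℕ → ℕ
  isZero zero    = 1
  isZero (suc _) = 0

  positives : ∀ {n} → Vector ℕ n → ℕ
  positives w = ℕ∑.sum (λ i → isPos (w i))

  zeros : ∀ {n} → Vector ℕ n → ℕ
  zeros w = ℕ∑.sum (λ i → isZero (w i))

  positives+zeros : ∀ {n} (w : Vector ℕ n) → positives w + zeros w ≡ n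
  positives+zeros {zero}  w = ≡.refl
  positives+zeros {suc n} w with w zero
  ... | zero  = ≡.trans (ℕ.+-suc (positives (tail w)) (zeros (tail w))) (≡.cong suc (positives+zeros (tail w)))
  ... | suc _ = ≡.cong suc (positives+zeros (tail w))

  positives≤length : ∀ {n} (w : Vector ℕ n) → positives w ≤ n
  positives≤length w = ≡.subst (positives w ≤_) (positives+zeros w) (ℕ.m≤m+n (positives w) (zeros w))

  sum≡0⇒zero : ∀ {n} (w : Vector ℕ n) → ℕ∑.sum w ≡ 0 → ∀ i → w i ≡ 0
  sum≡0⇒zero w Σw≡0 zero    = ℕ.m+n≡0⇒m≡0 (w zero) Σw≡0
  sum≡0⇒zero w Σw≡0 (suc i) = sum≡0⇒zero (tail w) (ℕ.m+n≡0⇒n≡0 (w zero) Σw≡0) i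

  zero⇒positives≡0 : ∀ {n} (w : Vector ℕ n) → (∀ i → w i ≡ 0) → positives w ≡ 0
  zero⇒positives≡0 {zero}  w w≡0 = ≡.refl
  zero⇒positives≡0 {suc n} w w≡0 rewrite w≡0 zero = zero⇒positives≡0 (tail w) (w≡0 ∘ suc)

  positives≡0⇒sum≡0 : ∀ {n} (w : Vector ℕ n) → positives w ≡ 0 → ℕ∑.sum w ≡ 0
  positives≡0⇒sum≡0 {zero}  w _ = ≡.refl
  positives≡0⇒sum≡0 {suc n} w p≡0 with w zero
  ... | zero = positives≡0⇒sum≡0 (tail w) p≡0

  sum-updateAt : ∀ {n} (g : Fin n → ℕ → ℕ) (w : Vector ℕ n) (i : Fin n) (h : ℕ → ℕ) →
                 ℕ∑.sum (λ j → g j (updateAt w i h j)) + g i (w i)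
                   ≡ ℕ∑.sum (λ j → g j (w j)) + g i (h (w i))
  sum-updateAt g w zero h = ℕ+.xy∙z≈zy∙x (g zero (h (w zero))) (ℕ∑.sum (λ j → g (suc j) (w (suc j)))) (g zero (w zero))
  sum-updateAt g w (suc i) h = begin
    (g zero (w zero) + S↑) + g (suc i) (w (suc i))   ≡⟨ ℕ.+-assoc (g zero (w zero)) S↑ _ ⟩
    g zero (w zero) + (S↑ + g (suc i) (w (suc i)))   ≡⟨ ≡.cong (g zero (w zero) +_) (sum-updateAt (g ∘ suc) (tail w) i h) ⟩
    g zero (w zero) + (S + g (suc i) (h (w (suc i)))) ≡⟨ ℕ.+-assoc (g zero (w zero)) S _ ⟨
    (g zero (w zero) + S) + g (suc i) (h (w (suc i))) ∎
    where
    open ≡-Reasoning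
    S↑ = ℕ∑.sum (λ j → g (suc j) (updateAt (tail w) i h j))
    S  = ℕ∑.sum (λ j → g (suc j) (w (suc j)))

  addAt : ∀ {n} → Vector ℕ n → Fin n → ℕ → Vector ℕ n
  addAt w i a = updateAt w i (_+ a)

  sum-addAt : ∀ {n} (w : Vector ℕ n) i a → ℕ∑.sum (addAt w i a) ≡ a + ℕ∑.sum w
  sum-addAt w i a = ℕ.+-cancelʳ-≡ (w i) _ _ (begin
    ℕ∑.sum (addAt w i a) + w i  ≡⟨ sum-updateAt (λ _ x → x) w i (_+ a) ⟩
    ℕ∑.sum w + (w i + a)        ≡⟨ ℕ+.x∙yz≈zx∙y (ℕ∑.sum w) (w i) a ⟩
    (a + ℕ∑.sum w) + w i        ∎)
    where open ≡-Reasoning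

  weightedSum-addAt : ∀ {n} (c w : Vector ℕ n) i a →
                      ℕ∑.sum (λ j → c j * addAt w i a j) ≡ c i * a + ℕ∑.sum (λ j → c j * w j)
  weightedSum-addAt c w i a = ℕ.+-cancelʳ-≡ (c i * w i) _ _ (begin
    ℕ∑.sum (λ j → c j * addAt w i a j) + c i * w i  ≡⟨ sum-updateAt (λ j x → c j * x) w i (_+ a) ⟩
    S + c i * (w i + a)                             ≡⟨ ≡.cong (S +_) (ℕ.*-distribˡ-+ (c i) (w i) a) ⟩
    S + (c i * w i + c i * a)                       ≡⟨ ℕ+.x∙yz≈zx∙y S (c i * w i) (c i * a) ⟩
    (c i * a + S) + c i * w i                       ∎)
    where
    open ≡-Reasoning
    S = ℕ∑.sum (λ j → c j * w j)

  isPos-pos : ∀ {x} → 0 < x → isPos x ≡ 1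
  isPos-pos {suc _} _ = ≡.refl

  isZero-pos : ∀ {x} → 0 < x → isZero x ≡ 0
  isZero-pos {suc _} _ = ≡.refl

  positives-addAt : ∀ {n} (w : Vector ℕ n) i a →
                    positives (addAt w i a) + isPos (w i) ≡ positives w + isPos (w i + a)
  positives-addAt w i a = sum-updateAt (λ _ → isPos) w i (_+ a)

  zeros-addAt : ∀ {n} (w : Vector ℕ n) i a →
                zeros (addAt w i a) + isZero (w i) ≡ zeros w + isZero (w i + a)
  zeros-addAt w i a = sum-updateAt (λ _ → isZero) w i (_+ a)

  positives-addAt-pos : ∀ {n} (w : Vector ℕ n) i a → 0 < w i → positives (addAt w i a) ≡ positives w
  positives-addAt-pos w i a 0<wi = ℕ.+-cancelʳ-≡ (isPos (w i)) _ _ (begin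
    positives (addAt w i a) + isPos (w i)  ≡⟨ positives-addAt w i a ⟩
    positives w + isPos (w i + a)          ≡⟨ ≡.cong (positives w +_) (≡.trans (isPos-pos 0<wi+a) (≡.sym (isPos-pos 0<wi))) ⟩
    positives w + isPos (w i)              ∎)
    where
    open ≡-Reasoning
    0<wi+a = ℕ.<-≤-trans 0<wi (ℕ.m≤m+n (w i) a)

  zeros-addAt-pos : ∀ {n} (w : Vector ℕ n) i a → 0 < w i → zeros (addAt w i a) ≡ zeros w
  zeros-addAt-pos w i a 0<wi = ℕ.+-cancelʳ-≡ (isZero (w i)) _ _ (begin
    zeros (addAt w i a) + isZero (w i)  ≡⟨ zeros-addAt w i a ⟩
    zeros w + isZero (w i + a)          ≡⟨ ≡.cong (zeros w +_) (≡.trans (isZero-pos 0<wi+a) (≡.sym (isZero-pos 0<wi))) ⟩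
    zeros w + isZero (w i)              ∎)
    where
    open ≡-Reasoning
    0<wi+a = ℕ.<-≤-trans 0<wi (ℕ.m≤m+n (w i) a)

  positives-addAt-zero : ∀ {n} (w : Vector ℕ n) i a → w i ≡ 0 → 0 < a →
                         positives (addAt w i a) ≡ suc (positives w)
  positives-addAt-zero w i a wi≡0 0<a = begin
    positives (addAt w i a)                ≡⟨ ℕ.+-identityʳ _ ⟨
    positives (addAt w i a) + 0            ≡⟨ ≡.cong (λ x → positives (addAt w i a) + isPos x) wi≡0 ⟨
    positives (addAt w i a) + isPos (w i)  ≡⟨ positives-addAt w i a ⟩
    positives w + isPos (w i + a)          ≡⟨ ≡.cong (positives w +_) (isPos-pos 0<wi+a) ⟩
    positives w + 1                        ≡⟨ ℕ.+-comm (positives w) 1 ⟩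
    suc (positives w)                      ∎
    where
    open ≡-Reasoning
    0<wi+a = ℕ.<-≤-trans 0<a (ℕ.m≤n+m a (w i))

  zeros-addAt-zero : ∀ {n} (w : Vector ℕ n) i a → w i ≡ 0 → 0 < a →
                     zeros (addAt w i a) ≡ zeros w ∸ 1
  zeros-addAt-zero w i a wi≡0 0<a = ≡.cong (_∸ 1) (begin
    suc (zeros (addAt w i a))              ≡⟨ ℕ.+-comm 1 _ ⟩
    zeros (addAt w i a) + 1                ≡⟨ ≡.cong (λ x → zeros (addAt w i a) + isZero x) wi≡0 ⟨
    zeros (addAt w i a) + isZero (w i)     ≡⟨ zeros-addAt w i a ⟩
    zeros w + isZero (w i + a)             ≡⟨ ≡.cong (zeros w +_) (isZero-pos 0<wi+a) ⟩
    zeros w + 0                            ≡⟨ ℕ.+-identityʳ (zeros w) ⟩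
    zeros w                                ∎)
    where
    open ≡-Reasoning
    0<wi+a = ℕ.<-≤-trans 0<a (ℕ.m≤n+m a (w i))

  foldr-tabulate : ∀ {a b} {A : Set a} {B : Set b} (f : A → B → B) (e : B) {n} (t : Vector A n) →
                   foldr f e (tabulate t) ≡ Vector.foldr f e t
  foldr-tabulate f e {zero}  t = ≡.refl
  foldr-tabulate f e {suc n} t = ≡.cong (f (t zero)) (foldr-tabulate f e (tail t))

  listSum-allFin : ∀ {n} (h : Vector ℕ n) → List.sum (map h (allFin n)) ≡ ℕ∑.sum h
  listSum-allFin h = ≡.trans (≡.cong List.sum (map-tabulate (λ i → i) h)) (foldr-tabulate _+_ 0 h)

  length-filter-positive : ∀ {a} {A : Set a} (q : A → ℕ) {n} (t : Vector A n) →
                           length (filter (λ x → 0 <? q x) (tabulate t)) ≡ positives (q ∘ t)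
  length-filter-positive q {zero}  t = ≡.refl
  length-filter-positive q {suc n} t with q (t zero)
  ... | zero  = length-filter-positive q (tail t)
  ... | suc _ = ≡.cong suc (length-filter-positive q (tail t))

  ell≡positives : ∀ {m} (ν : Vector ℕ m) → ell ν ≡ positives ν
  ell≡positives ν = length-filter-positive ν (λ i → i)

open Counting

module RingSums {c ℓ} (R : CommutativeRing c ℓ) where
  open CommutativeRing R hiding (zero)
  open import Relation.Binary.Reasoning.Setoid setoid
  open import Algebra.Properties.Semiring.Sum semiring public
    using (sum; sum-cong-≋; ∑-comm; ∑-distrib-+; *-distribˡ-sum; *-distribʳ-sum; sum-replicate; sum-replicate-zero)
  open import Algebra.Properties.Semiring.Mult semiring using (×-homo-+; ×1-homo-*; ×-assoc-*; ×-congʳ)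
    renaming (_×_ to _·_)
  open import Algebra.Properties.Semiring.Exp semiring public using (_^_; ^-homo-*; ^-assocʳ; ^-congˡ; ^-congʳ)
  open import Algebra.Properties.Group +-group public using () renaming (∙-cancelʳ to +-cancelʳ)
  import Algebra.Properties.CommutativeSemigroup +-commutativeSemigroup as R+

  ι : ℕ → Carrier
  ι = natCast R

  ι≡× : ∀ n → ι n ≡ n · 1#
  ι≡× zero    = ≡.refl
  ι≡× (suc n) = ≡.cong (1# +_) (ι≡× n)

  ι-+ : ∀ a b → ι (a ℕ.+ b) ≈ ι a + ι b
  ι-+ a b rewrite ι≡× (a ℕ.+ b) | ι≡× a | ι≡× b = ×-homo-+ 1# a b

  ι-* : ∀ a b → ι (a ℕ.* b) ≈ ι a * ι b
  ι-* a b rewrite ι≡× (a ℕ.* b) | ι≡× a | ι≡× b = ×1-homo-* a b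

  pow≡^ : ∀ x n → pow R x n ≡ x ^ n
  pow≡^ x zero    = ≡.refl
  pow≡^ x (suc n) = ≡.cong (x *_) (pow≡^ x n)

  1^n≈1 : ∀ n → 1# ^ n ≈ 1#
  1^n≈1 zero    = refl
  1^n≈1 (suc n) = trans (*-identityˡ _) (1^n≈1 n)

  sum-const : ∀ {n} (h : Vector Carrier n) a → (∀ i → h i ≈ a) → sum h ≈ ι n * a
  sum-const {n} h a h≈a = begin
    sum h                       ≈⟨ sum-cong-≋ h≈a ⟩
    sum (Vector.replicate n a)  ≈⟨ sum-replicate n ⟩
    n · a                  ≈⟨ ×-congʳ n (*-identityˡ a) ⟨
    n · (1# * a)           ≈⟨ ×-assoc-* n 1# a ⟨
    (n · 1#) * a           ≡⟨ ≡.cong (_* a) (ι≡× n) ⟨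
    ι n * a                ∎

  sumOver : ∀ {a} {A : Set a} → (A → Carrier) → List A → Carrier
  sumOver g xs = rsum R (map g xs)

  module _ {a} {A : Set a} where

    sumOver-cong : ∀ {g h : A → Carrier} xs → (∀ x → g x ≈ h x) → sumOver g xs ≈ sumOver h xs
    sumOver-cong []       g≈h = refl
    sumOver-cong (x ∷ xs) g≈h = +-cong (g≈h x) (sumOver-cong xs g≈h)

    sumOver-+ : ∀ (g h : A → Carrier) xs → sumOver (λ x → g x + h x) xs ≈ sumOver g xs + sumOver h xs
    sumOver-+ g h []       = sym (+-identityˡ 0#)
    sumOver-+ g h (x ∷ xs) = trans (+-congˡ (sumOver-+ g h xs)) (R+.interchange (g x) (h x) _ _)

    *-distribˡ-sumOver : ∀ k (g : A → Carrier) xs → k * sumOver g xs ≈ sumOver (λ x → k * g x) xs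
    *-distribˡ-sumOver k g []       = zeroʳ k
    *-distribˡ-sumOver k g (x ∷ xs) = trans (distribˡ k (g x) _) (+-congˡ (*-distribˡ-sumOver k g xs))

    sumOver-++ : ∀ (g : A → Carrier) xs ys → sumOver g (xs ++ ys) ≈ sumOver g xs + sumOver g ys
    sumOver-++ g []       ys = sym (+-identityˡ _)
    sumOver-++ g (x ∷ xs) ys = trans (+-congˡ (sumOver-++ g xs ys)) (sym (+-assoc _ _ _))

    sumOver-sum : ∀ {n} (g : A → Vector Carrier n) xs →
                  sumOver (λ x → sum (g x)) xs ≈ sum (λ i → sumOver (λ x → g x i) xs)
    sumOver-sum {n} g []       = sym (sum-replicate-zero n)
    sumOver-sum     g (x ∷ xs) = trans (+-congˡ (sumOver-sum g xs)) (sym (∑-distrib-+ (g x) _))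

  sumOver-concatMap : ∀ {a b} {A : Set a} {B : Set b} (h : B → Carrier) (f : A → List B) xs →
                      sumOver h (concatMap f xs) ≈ sumOver (λ x → sumOver h (f x)) xs
  sumOver-concatMap h f []       = refl
  sumOver-concatMap h f (x ∷ xs) = trans (sumOver-++ h (f x) (concatMap f xs)) (+-congˡ (sumOver-concatMap h f xs))

  sumOver-map : ∀ {a b} {A : Set a} {B : Set b} (h : B → Carrier) (f : A → B) xs →
                sumOver h (map f xs) ≡ sumOver (h ∘ f) xs
  sumOver-map h f []       = ≡.refl
  sumOver-map h f (x ∷ xs) = ≡.cong (h (f x) +_) (sumOver-map h f xs)

  sumOver-allFin : ∀ {n} (h : Vector Carrier n) → sumOver h (allFin n) ≡ sum h
  sumOver-allFin {n} h = ≡.trans (≡.cong (rsum R) (map-tabulate (λ i → i) h)) (foldr-tabulate _+_ 0# h)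

  ind : ∀ {p} {P : Set p} → Dec P → Carrier
  ind d = if does d then 1# else 0#

  module _ {p} {P : Set p} where

    ind-yes : (d : Dec P) → P → ind d ≈ 1#
    ind-yes (yes _) _  = refl
    ind-yes (no ¬p) pr = ⊥-elim (¬p pr)

    ind-no : (d : Dec P) → ¬ P → ind d ≈ 0#
    ind-no (yes pr) ¬p = ⊥-elim (¬p pr)
    ind-no (no _)   _  = refl

  module _ {p q} {P : Set p} {Q : Set q} where

    ind-cong : (d : Dec P) (e : Dec Q) → (P → Q) → (Q → P) → ind d ≈ ind e
    ind-cong d (yes q) _   Q→P = ind-yes d (Q→P q)
    ind-cong d (no ¬q) P→Q _   = ind-no d (¬q ∘ P→Q)

    ind-× : ∀ {s} {S : Set s} (d : Dec P) (e : Dec Q) (f : Dec S) →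
            (P → Q × S) → (Q → S → P) → ind d ≈ ind e * ind f
    ind-× d (yes q) (yes s) _ mk = trans (ind-yes d (mk q s)) (sym (*-identityˡ 1#))
    ind-× d (yes _) (no ¬s) split _ = trans (ind-no d (¬s ∘ proj₂ ∘ split)) (sym (zeroʳ 1#))
    ind-× d (no ¬q) f split _ = trans (ind-no d (¬q ∘ proj₁ ∘ split)) (sym (zeroˡ (ind f)))

  sumOver-filter : ∀ {a p} {A : Set a} {Q : A → Set p} (Q? : ∀ x → Dec (Q x)) (g : A → Carrier) xs →
                   sumOver g (filter Q? xs) ≈ sumOver (λ x → ind (Q? x) * g x) xs
  sumOver-filter Q? g [] = refl
  sumOver-filter Q? g (x ∷ xs) with Q? x
  ... | yes _ = +-cong (sym (*-identityˡ (g x))) (sumOver-filter Q? g xs)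
  ... | no _  = trans (sumOver-filter Q? g xs) (sym (trans (+-congʳ (zeroˡ (g x))) (+-identityˡ _)))

  sum-zero : ∀ {n} (h : Vector Carrier n) → (∀ i → h i ≈ 0#) → sum h ≈ 0#
  sum-zero {n} h h≈0 = trans (sum-cong-≋ h≈0) (sum-replicate-zero n)

  sum-δ : ∀ {n} (a : Fin n) (h : Vector Carrier n) → sum (λ j → ind (a ≟ j) * h j) ≈ h a
  sum-δ zero    h = trans (+-cong (*-identityˡ (h zero)) (sum-zero _ (λ j → zeroˡ (h (suc j))))) (+-identityʳ (h zero))
  sum-δ (suc a) h = trans (+-congʳ (zeroˡ (h zero))) (trans (+-identityˡ _) (sum-δ a (tail h)))

  ι-sum : ∀ {n} (g : Vector ℕ n) → ι (ℕ∑.sum g) ≈ sum (ι ∘ g)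
  ι-sum {zero}  g = refl
  ι-sum {suc n} g = trans (ι-+ (g zero) _) (+-congˡ (ι-sum (tail g)))

  sum-by-sign : ∀ {n} (v : Vector ℕ n) (h : Vector Carrier n) a b →
                (∀ i → 0 < v i → h i ≈ a) → (∀ i → v i ≡ 0 → h i ≈ b) →
                sum h ≈ ι (positives v) * a + ι (zeros v) * b
  sum-by-sign v h a b pos zer = begin
    sum h                                            ≈⟨ sum-cong-≋ by-entry ⟩
    sum (λ i → ι (isPos (v i)) * a + ι (isZero (v i)) * b)
      ≈⟨ ∑-distrib-+ (λ i → ι (isPos (v i)) * a) (λ i → ι (isZero (v i)) * b) ⟩
    sum (λ i → ι (isPos (v i)) * a) + sum (λ i → ι (isZero (v i)) * b)
      ≈⟨ +-cong (*-distribʳ-sum a (ι ∘ isPos ∘ v)) (*-distribʳ-sum b (ι ∘ isZero ∘ v)) ⟨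
    sum (ι ∘ isPos ∘ v) * a + sum (ι ∘ isZero ∘ v) * b
      ≈⟨ +-cong (*-congʳ (ι-sum (isPos ∘ v))) (*-congʳ (ι-sum (isZero ∘ v))) ⟨
    ι (positives v) * a + ι (zeros v) * b            ∎
    where
    ι1≈1 : ι 1 ≈ 1#
    ι1≈1 = +-identityʳ 1#
    at-zero : ι 0 * a + ι 1 * b ≈ b
    at-zero = trans (+-cong (zeroˡ a) (*-congʳ ι1≈1)) (trans (+-identityˡ _) (*-identityˡ b))
    at-pos : ι 1 * a + ι 0 * b ≈ a
    at-pos = trans (+-cong (*-congʳ ι1≈1) (zeroˡ b)) (trans (+-identityʳ _) (*-identityˡ a))
    by-entry : ∀ i → h i ≈ ι (isPos (v i)) * a + ι (isZero (v i)) * b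
    by-entry i with v i in vᵢ≡
    ... | zero  = trans (zer i vᵢ≡) (sym at-zero)
    ... | suc _ = trans (pos i (≡.subst (0 <_) (≡.sym vᵢ≡) (ℕ.s≤s ℕ.z≤n))) (sym at-pos)

module InjectionSums {c ℓ} (R : CommutativeRing c ℓ) (m : ℕ) (ζ : CommutativeRing.Carrier R) where
  open CommutativeRing R hiding (zero)
  open RingSums R
  import Algebra.Properties.CommutativeSemigroup *-commutativeSemigroup as R*
  open import Relation.Binary.Reasoning.Setoid setoid

  Inj : ∀ {k} → (Fin k → Fin m) → Set
  Inj f = ∀ i j → f i ≡ f j → i ≡ j

  inj? : ∀ {k} (f : Fin k → Fin m) → Dec (Inj f)
  inj? f = all? (λ i → all? (λ j → (f i ≟ f j) →-dec (i ≟ j)))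

  NotIn : ∀ {k} → Fin m → (Fin k → Fin m) → Set
  NotIn j f = ¬ ∃ λ i → f i ≡ j

  notIn? : ∀ {k} (j : Fin m) (f : Fin k → Fin m) → Dec (NotIn j f)
  notIn? j f = ¬? (any? (λ i → f i ≟ j))

  -- The exponent Σᵢ f(i)·wᵢ, values of f counted from 0.
  E : ∀ {k} → (Fin k → Fin m) → Vector ℕ k → ℕ
  E f w = ℕ∑.sum (λ i → toℕ (f i) ℕ.* w i)

  F : ∀ k → Vector ℕ k → Carrier
  F k w = sumOver (λ f → ind (inj? f) * ζ ^ E f w) (allFuns k m)

  G : ℕ → Carrier
  G a = sum (λ (j : Fin m) → ζ ^ (toℕ j ℕ.* a))

  notIn+preimages : ∀ {n} (f : Fin n → Fin m) → Inj f → ∀ j →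
                    ind (notIn? j f) + sum (λ i → ind (f i ≟ j)) ≈ 1#
  notIn+preimages f inj j with any? (λ i → f i ≟ j)
  ... | yes (i₀ , fi₀≡j) = begin
    0# + sum (λ i → ind (f i ≟ j))          ≈⟨ +-identityˡ _ ⟩
    sum (λ i → ind (f i ≟ j))               ≈⟨ sum-cong-≋ preimage-is-i₀ ⟩
    sum (λ i → ind (i₀ ≟ i) * 1#)           ≈⟨ sum-δ i₀ (λ _ → 1#) ⟩
    1#                                       ∎
    where
    preimage-is-i₀ : ∀ i → ind (f i ≟ j) ≈ ind (i₀ ≟ i) * 1#
    preimage-is-i₀ i = trans (ind-cong (f i ≟ j) (i₀ ≟ i)
                                (λ fi≡j → inj i₀ i (≡.trans fi₀≡j (≡.sym fi≡j)))
                                (λ i₀≡i → ≡.trans (≡.cong f (≡.sym i₀≡i)) fi₀≡j))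
                             (sym (*-identityʳ _))
  ... | no ∄i = trans (+-congˡ (sum-zero (λ i → ind (f i ≟ j)) (λ i → ind-no (f i ≟ j) (λ fi≡j → ∄i (i , fi≡j))))) (+-identityʳ 1#)

  sum-complement+image : ∀ {n} (f : Fin n → Fin m) → Inj f → (h : Vector Carrier m) →
                         sum (λ j → ind (notIn? j f) * h j) + sum (h ∘ f) ≈ sum h
  sum-complement+image {n} f inj h = begin
    sum (λ j → ind (notIn? j f) * h j) + sum (h ∘ f)
      ≈⟨ +-congˡ (sum-cong-≋ (λ i → sym (sum-δ (f i) h))) ⟩
    sum (λ j → ind (notIn? j f) * h j) + sum (λ i → sum (λ j → ind (f i ≟ j) * h j))
      ≈⟨ +-congˡ (∑-comm (λ i j → ind (f i ≟ j) * h j)) ⟩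
    sum (λ j → ind (notIn? j f) * h j) + sum (λ j → sum (λ i → ind (f i ≟ j) * h j))
      ≈⟨ +-congˡ (sum-cong-≋ (λ j → sym (*-distribʳ-sum (h j) (λ i → ind (f i ≟ j))))) ⟩
    sum (λ j → ind (notIn? j f) * h j) + sum (λ j → sum (λ i → ind (f i ≟ j)) * h j)
      ≈⟨ ∑-distrib-+ (λ j → ind (notIn? j f) * h j) (λ j → sum (λ i → ind (f i ≟ j)) * h j) ⟨
    sum (λ j → ind (notIn? j f) * h j + sum (λ i → ind (f i ≟ j)) * h j)
      ≈⟨ sum-cong-≋ (λ j → trans (sym (distribʳ (h j) _ _)) (trans (*-congʳ (notIn+preimages f inj j)) (*-identityˡ (h j)))) ⟩
    sum h ∎

  record Extends {n} (g : Fin (suc n) → Fin m) (j : Fin m) (f : Fin n → Fin m) : Set where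
    constructor extends
    field
      at-zero : g zero ≡ j
      at-suc  : ∀ i → g (suc i) ≡ f i

  allFuns-suc : ∀ n → Σ[ ext ∈ ((Fin n → Fin m) → Fin m → Fin (suc n) → Fin m) ]
                  (∀ f j → Extends (ext f j) j f)
                  × allFuns (suc n) m ≡ concatMap (λ f → map (ext f) (allFin m)) (allFuns n m)
  allFuns-suc n = _ , (λ f j → extends ≡.refl (λ i → ≡.refl)) , ≡.refl

  module _ {n} {g : Fin (suc n) → Fin m} {j : Fin m} {f : Fin n → Fin m} (g-ext : Extends g j f) where

    ind-inj-extends : ind (inj? g) ≈ ind (inj? f) * ind (notIn? j f)
    ind-inj-extends = ind-× (inj? g) (inj? f) (notIn? j f) split join
      where
      open Extends g-ext renaming (at-zero to g0≡j; at-suc to gs≡f)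
      split : Inj g → Inj f × NotIn j f
      split inj-g = (λ i i′ fi≡fi′ → suc-injective (inj-g (suc i) (suc i′) (≡.trans (gs≡f i) (≡.trans fi≡fi′ (≡.sym (gs≡f i′))))))
                  , (λ { (i , fi≡j) → 0≢1+n (inj-g zero (suc i) (≡.trans g0≡j (≡.sym (≡.trans (gs≡f i) fi≡j)))) })
      join : Inj f → NotIn j f → Inj g
      join inj-f j∉f zero    zero     _ = ≡.refl
      join inj-f j∉f zero    (suc i′) g0≡gi′ = ⊥-elim (j∉f (i′ , ≡.trans (≡.sym (gs≡f i′)) (≡.trans (≡.sym g0≡gi′) g0≡j)))
      join inj-f j∉f (suc i) zero     gi≡g0 = ⊥-elim (j∉f (i , ≡.trans (≡.sym (gs≡f i)) (≡.trans gi≡g0 g0≡j)))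
      join inj-f j∉f (suc i) (suc i′) gi≡gi′ = ≡.cong suc (inj-f i i′ (≡.trans (≡.sym (gs≡f i)) (≡.trans gi≡gi′ (gs≡f i′))))

    E-extends : ∀ w → E g w ≡ toℕ j ℕ.* w zero ℕ.+ E f (tail w)
    E-extends w = ≡.cong₂ ℕ._+_ (≡.cong (λ x → toℕ x ℕ.* w zero) (Extends.at-zero g-ext))
                                 (ℕ∑.sum-cong-≗ (λ i → ≡.cong (λ x → toℕ x ℕ.* w (suc i)) (Extends.at-suc g-ext i)))

  E-addAt : ∀ {n} (f : Fin n → Fin m) w i a → E f (addAt w i a) ≡ toℕ (f i) ℕ.* a ℕ.+ E f w
  E-addAt f = weightedSum-addAt (toℕ ∘ f)

  ind-*-cong : ∀ {p} {P : Set p} (d : Dec P) {x y} → (P → x ≈ y) → ind d * x ≈ ind d * y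
  ind-*-cong (yes pr) x≈y = *-congˡ (x≈y pr)
  ind-*-cong (no _)   _   = trans (zeroˡ _) (sym (zeroˡ _))

  extensions-sum : ∀ {n} (w : Vector ℕ (suc n)) (f : Fin n → Fin m) (ext : Fin m → Fin (suc n) → Fin m) →
                   (∀ j → Extends (ext j) j f) →
                   sum (λ j → ind (inj? (ext j)) * ζ ^ E (ext j) w)
                     + sum (λ i → ind (inj? f) * ζ ^ E f (addAt (tail w) i (w zero)))
                   ≈ G (w zero) * (ind (inj? f) * ζ ^ E f (tail w))
  extensions-sum w f ext ext-f = begin
    sum (λ j → ind (inj? (ext j)) * ζ ^ E (ext j) w) + sum (λ i → ind (inj? f) * ζ ^ E f (addAt w′ i a₀))
      ≈⟨ +-cong (sum-cong-≋ extension-term) (sum-cong-≋ addAt-term) ⟩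
    sum (λ j → X * (ind (notIn? j f) * h j)) + sum (λ i → X * h (f i))
      ≈⟨ +-cong (*-distribˡ-sum X (λ j → ind (notIn? j f) * h j)) (*-distribˡ-sum X (h ∘ f)) ⟨
    X * sum (λ j → ind (notIn? j f) * h j) + X * sum (h ∘ f)
      ≈⟨ distribˡ X _ _ ⟨
    X * (sum (λ j → ind (notIn? j f) * h j) + sum (h ∘ f))
      ≈⟨ *-assoc _ _ _ ⟩
    ind (inj? f) * (ζ ^ E f w′ * (sum (λ j → ind (notIn? j f) * h j) + sum (h ∘ f)))
      ≈⟨ ind-*-cong (inj? f) (λ inj-f → *-congˡ (sum-complement+image f inj-f h)) ⟩
    ind (inj? f) * (ζ ^ E f w′ * G a₀)
      ≈⟨ R*.x∙yz≈z∙xy _ _ _ ⟩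
    G a₀ * X ∎
    where
    a₀ = w zero
    w′ = tail w
    X = ind (inj? f) * ζ ^ E f w′
    h : Vector Carrier m
    h j = ζ ^ (toℕ j ℕ.* a₀)
    extension-term : ∀ j → ind (inj? (ext j)) * ζ ^ E (ext j) w ≈ X * (ind (notIn? j f) * h j)
    extension-term j = begin
      ind (inj? (ext j)) * ζ ^ E (ext j) w
        ≈⟨ *-cong (ind-inj-extends (ext-f j)) (reflexive (≡.cong (ζ ^_) (E-extends (ext-f j) w))) ⟩
      (ind (inj? f) * ind (notIn? j f)) * ζ ^ (toℕ j ℕ.* a₀ ℕ.+ E f w′)
        ≈⟨ *-congˡ (^-homo-* ζ (toℕ j ℕ.* a₀) (E f w′)) ⟩
      (ind (inj? f) * ind (notIn? j f)) * (h j * ζ ^ E f w′)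
        ≈⟨ *-congˡ (*-comm _ _) ⟩
      (ind (inj? f) * ind (notIn? j f)) * (ζ ^ E f w′ * h j)
        ≈⟨ R*.interchange _ _ _ _ ⟩
      X * (ind (notIn? j f) * h j) ∎
    addAt-term : ∀ i → ind (inj? f) * ζ ^ E f (addAt w′ i a₀) ≈ X * h (f i)
    addAt-term i = begin
      ind (inj? f) * ζ ^ E f (addAt w′ i a₀)          ≈⟨ *-congˡ (reflexive (≡.cong (ζ ^_) (E-addAt f w′ i a₀))) ⟩
      ind (inj? f) * ζ ^ (toℕ (f i) ℕ.* a₀ ℕ.+ E f w′) ≈⟨ *-congˡ (^-homo-* ζ (toℕ (f i) ℕ.* a₀) (E f w′)) ⟩
      ind (inj? f) * (h (f i) * ζ ^ E f w′)            ≈⟨ *-congˡ (*-comm _ _) ⟩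
      ind (inj? f) * (ζ ^ E f w′ * h (f i))            ≈⟨ *-assoc _ _ _ ⟨
      X * h (f i)                                      ∎

  F-recursion : ∀ {n} (w : Vector ℕ (suc n)) →
                F (suc n) w + sum (λ i → F n (addAt (tail w) i (w zero))) ≈ G (w zero) * F n (tail w)
  F-recursion {n} w with allFuns-suc n
  ... | ext , ext-f , enumeration = begin
    F (suc n) w + sum (λ i → F n (addAt w′ i a₀))
      ≈⟨ +-cong by-extensions (sym (sumOver-sum ψ fs)) ⟩
    sumOver (λ f → sum (φ ∘ ext f)) fs + sumOver (λ f → sum (ψ f)) fs
      ≈⟨ sumOver-+ (λ f → sum (φ ∘ ext f)) (λ f → sum (ψ f)) fs ⟨
    sumOver (λ f → sum (φ ∘ ext f) + sum (ψ f)) fs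
      ≈⟨ sumOver-cong fs (λ f → extensions-sum w f (ext f) (ext-f f)) ⟩
    sumOver (λ f → G a₀ * (ind (inj? f) * ζ ^ E f w′)) fs
      ≈⟨ *-distribˡ-sumOver (G a₀) (λ f → ind (inj? f) * ζ ^ E f w′) fs ⟨
    G a₀ * F n w′ ∎
    where
    a₀ = w zero
    w′ = tail w
    fs = allFuns n m
    φ : (Fin (suc n) → Fin m) → Carrier
    φ g = ind (inj? g) * ζ ^ E g w
    ψ : (Fin n → Fin m) → Vector Carrier n
    ψ f i = ind (inj? f) * ζ ^ E f (addAt w′ i a₀)
    by-extensions : F (suc n) w ≈ sumOver (λ f → sum (φ ∘ ext f)) fs
    by-extensions = begin
      F (suc n) w                                                ≡⟨ ≡.cong (sumOver φ) enumeration ⟩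
      sumOver φ (concatMap (λ f → map (ext f) (allFin m)) fs)    ≈⟨ sumOver-concatMap φ (λ f → map (ext f) (allFin m)) fs ⟩
      sumOver (λ f → sumOver φ (map (ext f) (allFin m))) fs
        ≈⟨ sumOver-cong fs (λ f → reflexive (≡.trans (sumOver-map φ (ext f) (allFin m)) (sumOver-allFin (φ ∘ ext f)))) ⟩
      sumOver (λ f → sum (φ ∘ ext f)) fs                        ∎

  -- The exponent of u counts the values of σ from 1, which contributes the
  -- factor ζ^(Σ ν).
  u≈F : ∀ (ν : Vector ℕ m) → u R m ζ ν ≈ ζ ^ ℕ∑.sum ν * F m ν
  u≈F ν = begin
    u R m ζ ν
      ≈⟨ sumOver-filter injective? (λ σ → pow R ζ (List.sum (map (exponent σ) (allFin m)))) (allFuns m m) ⟩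
    sumOver (λ σ → ind (inj? σ) * pow R ζ (List.sum (map (exponent σ) (allFin m)))) (allFuns m m)
      ≈⟨ sumOver-cong (allFuns m m) term ⟩
    sumOver (λ σ → ζ ^ ℕ∑.sum ν * (ind (inj? σ) * ζ ^ E σ ν)) (allFuns m m)
      ≈⟨ *-distribˡ-sumOver (ζ ^ ℕ∑.sum ν) (λ σ → ind (inj? σ) * ζ ^ E σ ν) (allFuns m m) ⟨
    ζ ^ ℕ∑.sum ν * F m ν ∎
    where
    exponent : (Fin m → Fin m) → Vector ℕ m
    exponent σ i = suc (toℕ (σ i)) ℕ.* ν i
    exponent-sum : ∀ σ → List.sum (map (exponent σ) (allFin m)) ≡ ℕ∑.sum ν ℕ.+ E σ ν
    exponent-sum σ = ≡.trans (listSum-allFin (exponent σ)) (ℕ∑.∑-distrib-+ ν (λ i → toℕ (σ i) ℕ.* ν i))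
    term : ∀ σ → ind (inj? σ) * pow R ζ (List.sum (map (exponent σ) (allFin m)))
                 ≈ ζ ^ ℕ∑.sum ν * (ind (inj? σ) * ζ ^ E σ ν)
    term σ = begin
      ind (inj? σ) * pow R ζ (List.sum (map (exponent σ) (allFin m)))
        ≡⟨ ≡.cong (λ k → ind (inj? σ) * k) (≡.trans (pow≡^ ζ (List.sum (map (exponent σ) (allFin m)))) (≡.cong (ζ ^_) (exponent-sum σ))) ⟩
      ind (inj? σ) * ζ ^ (ℕ∑.sum ν ℕ.+ E σ ν)      ≈⟨ *-congˡ (^-homo-* ζ (ℕ∑.sum ν) (E σ ν)) ⟩
      ind (inj? σ) * (ζ ^ ℕ∑.sum ν * ζ ^ E σ ν)    ≈⟨ R*.x∙yz≈y∙xz _ _ _ ⟩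
      ζ ^ ℕ∑.sum ν * (ind (inj? σ) * ζ ^ E σ ν)    ∎

module GeometricSums {c ℓ} (R : CommutativeRing c ℓ) where
  open CommutativeRing R hiding (zero)
  open RingSums R
  open import Relation.Binary.Reasoning.Setoid setoid
  import Algebra.Properties.CommutativeSemigroup +-commutativeSemigroup as R+
  open import Algebra.Properties.Group +-group using (x∙y⁻¹≈ε⇒x≈y)
  open import Algebra.Properties.Ring ring using (-1*x≈-x)

  powerSum : Carrier → ℕ → Carrier
  powerSum y k = sum (λ (j : Fin k) → y ^ toℕ j)

  geometric : ∀ y k → y * powerSum y k + 1# ≈ powerSum y k + y ^ k
  geometric y zero    = +-congʳ (zeroʳ y)
  geometric y (suc k) = begin
    y * (1# + y·S) + 1#         ≈⟨ +-congʳ (*-congˡ (+-comm 1# y·S)) ⟩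
    y * (y·S + 1#) + 1#         ≈⟨ +-congʳ (*-congˡ (+-congʳ (*-distribˡ-sum y (λ (j : Fin k) → y ^ toℕ j)))) ⟨
    y * (y * S + 1#) + 1#       ≈⟨ +-congʳ (*-congˡ (geometric y k)) ⟩
    y * (S + y ^ k) + 1#        ≈⟨ +-congʳ (distribˡ y S (y ^ k)) ⟩
    (y * S + y ^ suc k) + 1#    ≈⟨ R+.xy∙z≈zx∙y (y * S) (y ^ suc k) 1# ⟩
    (1# + y * S) + y ^ suc k    ≈⟨ +-congʳ (+-congˡ (*-distribˡ-sum y (λ (j : Fin k) → y ^ toℕ j))) ⟩
    (1# + y·S) + y ^ suc k      ∎
    where
    S   = powerSum y k
    y·S = sum (λ (j : Fin k) → y * y ^ toℕ j)

  powerSum-root : NoZeroDivisors R → ∀ {m} y → y ^ m ≈ 1# → ¬ (y ≈ 1#) → powerSum y m ≈ 0#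
  powerSum-root noZeroDivisors {m} y yᵐ≈1 y≉1 with noZeroDivisors (y - 1#) S [y-1]S≈0
    where
    S = powerSum y m
    yS≈S : y * S ≈ S
    yS≈S = +-cancelʳ 1# (y * S) S (trans (geometric y m) (+-congˡ yᵐ≈1))
    [y-1]S≈0 : (y - 1#) * S ≈ 0#
    [y-1]S≈0 = begin
      (y - 1#) * S        ≈⟨ distribʳ S y (- 1#) ⟩
      y * S + - 1# * S    ≈⟨ +-cong yS≈S (-1*x≈-x S) ⟩
      S - S               ≈⟨ -‿inverseʳ S ⟩
      0#                  ∎
  ... | inj₁ y-1≈0 = ⊥-elim (y≉1 (x∙y⁻¹≈ε⇒x≈y y 1# y-1≈0))
  ... | inj₂ S≈0   = S≈0

module ClosedForm {c ℓ} (R : CommutativeRing c ℓ) (noZeroDivisors : NoZeroDivisors R)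
                  (m : ℕ) (ζ : CommutativeRing.Carrier R) (ζ-primitive : IsPrimitiveRoot R m ζ) where
  open CommutativeRing R hiding (zero)
  open RingSums R
  open InjectionSums R m ζ
  open GeometricSums R
  open import Relation.Binary.Reasoning.Setoid setoid
  import Algebra.Properties.CommutativeSemigroup +-commutativeSemigroup as R+
  import Algebra.Properties.CommutativeSemigroup *-commutativeSemigroup as R*
  open import Algebra.Properties.Ring ring using (-1*x≈-x)
  open import Algebra.Solver.CommutativeMonoid *-commutativeMonoid using (_⊕_; _⊜_) renaming (solve to *-solve)

  ζᵐ≈1 : ζ ^ m ≈ 1#
  ζᵐ≈1 = ≡.subst (_≈ 1#) (pow≡^ ζ m) (proj₁ ζ-primitive)

  G≈powerSum : ∀ a → G a ≈ powerSum (ζ ^ a) m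
  G≈powerSum a = sum-cong-≋ (λ (j : Fin m) → trans (^-congʳ ζ (ℕ.*-comm (toℕ j) a)) (sym (^-assocʳ ζ a (toℕ j))))

  G-trivial : ∀ a → ζ ^ a ≈ 1# → G a ≈ ι m
  G-trivial a ζᵃ≈1 = begin
    G a                   ≈⟨ G≈powerSum a ⟩
    powerSum (ζ ^ a) m    ≈⟨ sum-const (λ (j : Fin m) → (ζ ^ a) ^ toℕ j) 1# (λ j → trans (^-congˡ (toℕ j) ζᵃ≈1) (1^n≈1 (toℕ j))) ⟩
    ι m * 1#              ≈⟨ *-identityʳ (ι m) ⟩
    ι m                   ∎

  -- G a = 0 for 0 < a < m, as ζ^a is then an m-th root of unity other than 1.
  G-vanish : ∀ a → 0 < a → a < m → G a ≈ 0#
  G-vanish a 0<a a<m = trans (G≈powerSum a) (powerSum-root noZeroDivisors {m} (ζ ^ a) ζᵃᵐ≈1 ζᵃ≉1)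
    where
    ζᵃᵐ≈1 : (ζ ^ a) ^ m ≈ 1#
    ζᵃᵐ≈1 = begin
      (ζ ^ a) ^ m    ≈⟨ ^-assocʳ ζ a m ⟩
      ζ ^ (a ℕ.* m)  ≡⟨ ≡.cong (ζ ^_) (ℕ.*-comm a m) ⟩
      ζ ^ (m ℕ.* a)  ≈⟨ ^-assocʳ ζ m a ⟨
      (ζ ^ m) ^ a    ≈⟨ ^-congˡ a ζᵐ≈1 ⟩
      1# ^ a         ≈⟨ 1^n≈1 a ⟩
      1#             ∎
    ζᵃ≉1 : ¬ (ζ ^ a ≈ 1#)
    ζᵃ≉1 ζᵃ≈1 = proj₂ ζ-primitive a 0<a a<m (≡.subst (_≈ 1#) (≡.sym (pow≡^ ζ a)) ζᵃ≈1)

  A : ℕ → Carrier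
  A l = ι m * pow R (- 1#) (l ∸ 1) * ι ((l ∸ 1) !)

  Closed : ℕ → ℕ → Carrier
  Closed l z = A l * ι ((m ∸ l) ↓ z)

  A-one : A 1 ≈ ι m
  A-one = trans (*-congˡ (+-identityʳ 1#)) (trans (*-identityʳ _) (*-identityʳ _))

  A-step : ∀ p → A (suc (suc p)) + ι (suc p) * A (suc p) ≈ 0#
  A-step p = begin
    (ι m * (- 1# * s) * ι (suc p !)) + ι (suc p) * A (suc p)
      ≈⟨ +-congʳ (*-congˡ (ι-* (suc p) (p !))) ⟩
    (ι m * (- 1# * s) * (ι (suc p) * ι (p !))) + ι (suc p) * A (suc p)
      ≈⟨ +-congʳ (*-solve 5 (λ M N S P Q → ((M ⊕ (N ⊕ S)) ⊕ (P ⊕ Q)) ⊜ (N ⊕ (P ⊕ ((M ⊕ S) ⊕ Q))))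
                          refl (ι m) (- 1#) s (ι (suc p)) (ι (p !))) ⟩
    - 1# * (ι (suc p) * A (suc p)) + ι (suc p) * A (suc p)
      ≈⟨ +-congʳ (-1*x≈-x _) ⟩
    - (ι (suc p) * A (suc p)) + ι (suc p) * A (suc p)
      ≈⟨ -‿inverseˡ _ ⟩
    0# ∎
    where s = pow R (- 1#) p

  Closed-suc : ∀ l z → Closed l (suc z) ≈ ι (m ∸ (l ℕ.+ z)) * Closed l z
  Closed-suc l z = begin
    A l * ι ((m ∸ l) ↓ suc z)               ≡⟨ ≡.cong (λ k → A l * ι k) (↓-suc (m ∸ l) z) ⟩
    A l * ι ((m ∸ l ∸ z) ℕ.* ((m ∸ l) ↓ z))  ≈⟨ *-congˡ (ι-* (m ∸ l ∸ z) _) ⟩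
    A l * (ι (m ∸ l ∸ z) * ι ((m ∸ l) ↓ z))  ≈⟨ R*.x∙yz≈y∙xz _ _ _ ⟩
    ι (m ∸ l ∸ z) * Closed l z               ≡⟨ ≡.cong (λ k → ι k * Closed l z) (ℕ.∸-+-assoc m l z) ⟩
    ι (m ∸ (l ℕ.+ z)) * Closed l z           ∎

  Closed-pascal : ∀ l z → l < m → Closed (suc l) z + ι z * Closed (suc l) (z ∸ 1) ≈ A (suc l) * ι ((m ∸ l) ↓ z)
  Closed-pascal l z l<m = begin
    A (suc l) * ι (k ↓ z) + ι z * (A (suc l) * ι (k ↓ (z ∸ 1)))
      ≈⟨ +-congˡ (R*.x∙yz≈y∙xz (ι z) (A (suc l)) (ι (k ↓ (z ∸ 1)))) ⟩
    A (suc l) * ι (k ↓ z) + A (suc l) * (ι z * ι (k ↓ (z ∸ 1)))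
      ≈⟨ distribˡ (A (suc l)) _ _ ⟨
    A (suc l) * (ι (k ↓ z) + ι z * ι (k ↓ (z ∸ 1)))
      ≈⟨ *-congˡ (+-congˡ (ι-* z _)) ⟨
    A (suc l) * (ι (k ↓ z) + ι (z ℕ.* (k ↓ (z ∸ 1))))
      ≈⟨ *-congˡ (ι-+ (k ↓ z) (z ℕ.* (k ↓ (z ∸ 1)))) ⟨
    A (suc l) * ι (k ↓ z ℕ.+ z ℕ.* (k ↓ (z ∸ 1)))
      ≡⟨ ≡.cong (λ t → A (suc l) * ι t) (≡.sym (↓-pascal k z)) ⟩
    A (suc l) * ι (suc k ↓ z)
      ≡⟨ ≡.cong (λ t → A (suc l) * ι (t ↓ z)) (ℕ.+-∸-assoc 1 l<m) ⟨
    A (suc l) * ι ((m ∸ l) ↓ z) ∎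
    where k = m ∸ suc l

  -- The identity behind the case 0 < w₀ < m of the induction.
  Closed-partial : ∀ p z → suc p < m →
                   Closed (suc (suc p)) z + (ι (suc p) * Closed (suc p) z + ι z * Closed (suc (suc p)) (z ∸ 1)) ≈ 0#
  Closed-partial p z p+1<m = begin
    C₂ z + (ι (suc p) * C₁ z + ι z * C₂ (z ∸ 1))      ≈⟨ R+.x∙yz≈xz∙y (C₂ z) _ _ ⟩
    (C₂ z + ι z * C₂ (z ∸ 1)) + ι (suc p) * C₁ z      ≈⟨ +-cong (Closed-pascal (suc p) z p+1<m) (sym (*-assoc _ _ _)) ⟩
    A (suc (suc p)) * F↓ + (ι (suc p) * A (suc p)) * F↓ ≈⟨ distribʳ F↓ _ _ ⟨
    (A (suc (suc p)) + ι (suc p) * A (suc p)) * F↓    ≈⟨ *-congʳ (A-step p) ⟩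
    0# * F↓                                           ≈⟨ zeroˡ F↓ ⟩
    0#                                                ∎
    where
    C₁ = Closed (suc p)
    C₂ = Closed (suc (suc p))
    F↓ = ι ((m ∸ suc p) ↓ z)

  F-cong : ∀ {k} {v v′ : Vector ℕ k} → (∀ i → v i ≡ v′ i) → F k v ≈ F k v′
  F-cong {k} v≗v′ = sumOver-cong (allFuns k m) (λ f → *-congˡ (reflexive (≡.cong (ζ ^_) (ℕ∑.sum-cong-≗ (λ i → ≡.cong (toℕ (f i) ℕ.*_) (v≗v′ i))))))

  F-empty : ∀ (w : Vector ℕ 0) → F 0 w ≈ 1#
  F-empty w = trans (+-identityʳ _) (trans (*-congʳ (ind-yes (inj? {0} (λ ())) (λ ()))) (*-identityˡ 1#))

  F-head-zero : ∀ {n} (w : Vector ℕ (suc n)) → w zero ≡ 0 → n ≤ m → F (suc n) w ≈ ι (m ∸ n) * F n (tail w)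
  F-head-zero {n} w w₀≡0 n≤m = +-cancelʳ (ι n * F n w′) _ _ (begin
    F (suc n) w + ι n * F n w′                          ≈⟨ +-congˡ (sum-const _ (F n w′) (λ i → F-cong (addAt-zero i))) ⟨
    F (suc n) w + sum (λ i → F n (addAt w′ i (w zero))) ≈⟨ F-recursion w ⟩
    G (w zero) * F n w′                                 ≈⟨ *-congʳ (G-trivial (w zero) (reflexive (≡.cong (ζ ^_) w₀≡0))) ⟩
    ι m * F n w′                                        ≡⟨ ≡.cong (λ k → ι k * F n w′) (ℕ.m∸n+n≡m n≤m) ⟨
    ι (m ∸ n ℕ.+ n) * F n w′                            ≈⟨ *-congʳ (ι-+ (m ∸ n) n) ⟩
    (ι (m ∸ n) + ι n) * F n w′                          ≈⟨ distribʳ (F n w′) _ _ ⟩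
    ι (m ∸ n) * F n w′ + ι n * F n w′                   ∎)
    where
    w′ = tail w
    addAt-zero : ∀ i → addAt w′ i (w zero) ≗ w′
    addAt-zero i = updateAt-id-local i w′ (≡.trans (≡.cong (w′ i ℕ.+_) w₀≡0) (ℕ.+-identityʳ (w′ i)))

  F-zeros : ∀ {n} (w : Vector ℕ n) → (∀ i → w i ≡ 0) → n ≤ m → F n w ≈ ι (m ↓ n)
  F-zeros {zero}  w _ _ = trans (F-empty w) (sym (+-identityʳ 1#))
  F-zeros {suc n} w w≡0 n<m = begin
    F (suc n) w                   ≈⟨ F-head-zero w (w≡0 zero) (ℕ.<⇒≤ n<m) ⟩
    ι (m ∸ n) * F n (tail w)      ≈⟨ *-congˡ (F-zeros (tail w) (w≡0 ∘ suc) (ℕ.<⇒≤ n<m)) ⟩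
    ι (m ∸ n) * ι (m ↓ n)         ≈⟨ ι-* (m ∸ n) (m ↓ n) ⟨
    ι ((m ∸ n) ℕ.* (m ↓ n))       ≡⟨ ≡.cong ι (↓-suc m n) ⟨
    ι (m ↓ suc n)                 ∎

  ClosedFormAt : ℕ → Set _
  ClosedFormAt n = ∀ (v : Vector ℕ n) → ℕ∑.sum v ≡ m → F n v ≈ Closed (positives v) (zeros v)

  Closed-cong : ∀ {l l′ z z′} → l ≡ l′ → z ≡ z′ → Closed l z ≈ Closed l′ z′
  Closed-cong l≡l′ z≡z′ = reflexive (≡.cong₂ Closed l≡l′ z≡z′)

  step-head-zero : ∀ {n} → ClosedFormAt n → suc n ≤ m → ∀ (w : Vector ℕ (suc n)) →
                   ℕ∑.sum w ≡ m → w zero ≡ 0 → F (suc n) w ≈ Closed (positives w) (zeros w)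
  step-head-zero {n} IH n<m w Σw≡m w₀≡0 = begin
    F (suc n) w                            ≈⟨ F-head-zero w w₀≡0 (ℕ.<⇒≤ n<m) ⟩
    ι (m ∸ n) * F n w′                     ≈⟨ *-congˡ (IH w′ (≡.trans (≡.cong (ℕ._+ ℕ∑.sum w′) (≡.sym w₀≡0)) Σw≡m)) ⟩
    ι (m ∸ n) * Closed l z                 ≡⟨ ≡.cong (λ k → ι (m ∸ k) * Closed l z) (positives+zeros w′) ⟨
    ι (m ∸ (l ℕ.+ z)) * Closed l z         ≈⟨ Closed-suc l z ⟨
    Closed l (suc z)                       ≈⟨ Closed-cong (≡.cong (λ x → isPos x ℕ.+ l) w₀≡0) (≡.cong (λ x → isZero x ℕ.+ z) w₀≡0) ⟨
    Closed (positives w) (zeros w)         ∎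
    where
    w′ = tail w
    l = positives w′
    z = zeros w′

  step-head-full : ∀ {n} → ClosedFormAt n → suc n ≤ m → ∀ (w : Vector ℕ (suc n)) →
                   ℕ∑.sum w ≡ m → w zero ≡ m → F (suc n) w ≈ Closed (positives w) (zeros w)
  step-head-full {n} IH n<m w Σw≡m w₀≡m = begin
    F (suc n) w                ≈⟨ +-cancelʳ (ι n * Closed 1 (n ∸ 1)) _ _ by-recursion ⟩
    Closed 1 n                 ≈⟨ Closed-cong (≡.sym positives≡1) (≡.sym zeros≡n) ⟩
    Closed (positives w) (zeros w) ∎
    where
    w′ = tail w
    0<m : 0 < m
    0<m = ℕ.<-≤-trans (ℕ.s≤s ℕ.z≤n) n<m
    w′≡0 : ∀ i → w′ i ≡ 0
    w′≡0 = sum≡0⇒zero w′ (ℕ.+-cancelˡ-≡ m _ _ (≡.trans (≡.cong (ℕ._+ ℕ∑.sum w′) (≡.sym w₀≡m))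
                                                 (≡.trans Σw≡m (≡.sym (ℕ.+-identityʳ m)))))
    positives′≡0 : positives w′ ≡ 0
    positives′≡0 = zero⇒positives≡0 w′ w′≡0
    positives≡1 : positives w ≡ 1
    positives≡1 = ≡.cong₂ ℕ._+_ (≡.trans (≡.cong isPos w₀≡m) (isPos-pos 0<m)) positives′≡0
    zeros′≡n : zeros w′ ≡ n
    zeros′≡n = ≡.trans (≡.cong (ℕ._+ zeros w′) (≡.sym positives′≡0)) (positives+zeros w′)
    zeros≡n : zeros w ≡ n
    zeros≡n = ≡.cong₂ ℕ._+_ (≡.trans (≡.cong isZero w₀≡m) (isZero-pos 0<m)) zeros′≡n
    -- Moving the whole mass m onto an entry of w′ leaves one positive entry.
    moved : ∀ i → F n (addAt w′ i (w zero)) ≈ Closed 1 (n ∸ 1)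
    moved i = trans (IH (addAt w′ i (w zero)) (≡.trans (sum-addAt w′ i (w zero)) Σw≡m))
                    (Closed-cong (≡.trans (positives-addAt-zero w′ i (w zero) (w′≡0 i) 0<w₀) (≡.cong suc positives′≡0))
                                 (≡.trans (zeros-addAt-zero w′ i (w zero) (w′≡0 i) 0<w₀) (≡.cong (_∸ 1) zeros′≡n)))
      where 0<w₀ = ≡.subst (0 <_) (≡.sym w₀≡m) 0<m
    by-recursion : F (suc n) w + ι n * Closed 1 (n ∸ 1) ≈ Closed 1 n + ι n * Closed 1 (n ∸ 1)
    by-recursion = begin
      F (suc n) w + ι n * Closed 1 (n ∸ 1)                 ≈⟨ +-congˡ (sum-const _ _ moved) ⟨
      F (suc n) w + sum (λ i → F n (addAt w′ i (w zero)))  ≈⟨ F-recursion w ⟩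
      G (w zero) * F n w′                                  ≈⟨ *-cong (G-trivial (w zero) (trans (reflexive (≡.cong (ζ ^_) w₀≡m)) ζᵐ≈1))
                                                                      (F-zeros w′ w′≡0 (ℕ.<⇒≤ n<m)) ⟩
      ι m * ι (m ↓ n)                                      ≈⟨ *-congʳ A-one ⟨
      A 1 * ι ((m ∸ 0) ↓ n)                                ≈⟨ Closed-pascal 0 n 0<m ⟨
      Closed 1 n + ι n * Closed 1 (n ∸ 1)                  ∎

  tail-has-positive : ∀ {n} (w : Vector ℕ (suc n)) → ℕ∑.sum w ≡ m → w zero < m →
                      ∃ λ p → positives (tail w) ≡ suc p
  tail-has-positive w Σw≡m w₀<m with positives (tail w) in positives′≡
  ... | suc p = p , ≡.refl
  ... | zero  = ⊥-elim (ℕ.<⇒≢ w₀<m w₀≡m)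
    where
    Σw′≡0 = positives≡0⇒sum≡0 (tail w) positives′≡
    w₀≡m : w zero ≡ m
    w₀≡m = ≡.trans (≡.sym (ℕ.+-identityʳ (w zero))) (≡.trans (≡.cong (w zero ℕ.+_) (≡.sym Σw′≡0)) Σw≡m)

  -- Inductive step when 0 < w₀ < m: then G w₀ = 0, and w′ has p+1 > 0
  -- positive entries.
  step-head-partial : ∀ {n} → ClosedFormAt n → suc n ≤ m → ∀ (w : Vector ℕ (suc n)) →
                      ℕ∑.sum w ≡ m → 0 < w zero → w zero < m → ∀ p → positives (tail w) ≡ suc p →
                      F (suc n) w ≈ Closed (positives w) (zeros w)
  step-head-partial {n} IH n<m w Σw≡m 0<w₀ w₀<m p positives′≡ = begin
    F (suc n) w                        ≈⟨ +-cancelʳ (sum moved) _ _ by-recursion ⟩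
    Closed (suc (suc p)) z             ≈⟨ Closed-cong (≡.cong₂ ℕ._+_ (isPos-pos 0<w₀) positives′≡)
                                                      (≡.cong (ℕ._+ z) (isZero-pos 0<w₀)) ⟨
    Closed (positives w) (zeros w)     ∎
    where
    w′ = tail w
    z = zeros w′
    moved : Vector Carrier n
    moved i = F n (addAt w′ i (w zero))
    Σmoved≡m : ∀ i → ℕ∑.sum (addAt w′ i (w zero)) ≡ m
    Σmoved≡m i = ≡.trans (sum-addAt w′ i (w zero)) Σw≡m
    -- Adding w₀ to a positive entry of w′ keeps the counts, adding it to a zero
    -- entry creates a new positive entry.
    moved-pos : ∀ i → 0 < w′ i → moved i ≈ Closed (suc p) z
    moved-pos i 0<w′ᵢ = trans (IH _ (Σmoved≡m i))
      (Closed-cong (≡.trans (positives-addAt-pos w′ i (w zero) 0<w′ᵢ) positives′≡) (zeros-addAt-pos w′ i (w zero) 0<w′ᵢ))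
    moved-zero : ∀ i → w′ i ≡ 0 → moved i ≈ Closed (suc (suc p)) (z ∸ 1)
    moved-zero i w′ᵢ≡0 = trans (IH _ (Σmoved≡m i))
      (Closed-cong (≡.trans (positives-addAt-zero w′ i (w zero) w′ᵢ≡0 0<w₀) (≡.cong suc positives′≡))
                   (zeros-addAt-zero w′ i (w zero) w′ᵢ≡0 0<w₀))
    p+1<m : suc p < m
    p+1<m = ℕ.≤-<-trans (≡.subst (_≤ n) positives′≡ (positives≤length w′)) n<m
    Σmoved : sum moved ≈ ι (suc p) * Closed (suc p) z + ι z * Closed (suc (suc p)) (z ∸ 1)
    Σmoved = trans (sum-by-sign w′ moved _ _ moved-pos moved-zero)
                   (+-congʳ (*-congʳ (reflexive (≡.cong ι positives′≡))))
    by-recursion : F (suc n) w + sum moved ≈ Closed (suc (suc p)) z + sum moved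
    by-recursion = begin
      F (suc n) w + sum moved      ≈⟨ F-recursion w ⟩
      G (w zero) * F n w′          ≈⟨ *-congʳ (G-vanish (w zero) 0<w₀ w₀<m) ⟩
      0# * F n w′                  ≈⟨ zeroˡ (F n w′) ⟩
      0#                           ≈⟨ Closed-partial p z p+1<m ⟨
      Closed (suc (suc p)) z + (ι (suc p) * Closed (suc p) z + ι z * Closed (suc (suc p)) (z ∸ 1))
                                   ≈⟨ +-congˡ Σmoved ⟨
      Closed (suc (suc p)) z + sum moved ∎

  head-cases : ∀ a → a ≤ m → (a ≡ 0) ⊎ (0 < a × a < m) ⊎ (a ≡ m)
  head-cases zero    _   = inj₁ ≡.refl
  head-cases (suc a) a≤m with ℕ.m≤n⇒m<n∨m≡n a≤m
  ... | inj₁ a<m = inj₂ (inj₁ (ℕ.s≤s ℕ.z≤n , a<m))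
  ... | inj₂ a≡m = inj₂ (inj₂ a≡m)

  closed-form-step : ∀ {n} → ClosedFormAt n → suc n ≤ m → ClosedFormAt (suc n)
  closed-form-step IH n<m w Σw≡m with head-cases (w zero) (≡.subst (w zero ≤_) Σw≡m (ℕ.m≤m+n (w zero) _))
  ... | inj₁ w₀≡0                 = step-head-zero IH n<m w Σw≡m w₀≡0
  ... | inj₂ (inj₂ w₀≡m)          = step-head-full IH n<m w Σw≡m w₀≡m
  ... | inj₂ (inj₁ (0<w₀ , w₀<m)) with tail-has-positive w Σw≡m w₀<m
  ...   | p , positives′≡ = step-head-partial IH n<m w Σw≡m 0<w₀ w₀<m p positives′≡

  closed-form : 1 ≤ m → ∀ n → n ≤ m → ClosedFormAt n
  closed-form 1≤m zero    _   v Σv≡m = ⊥-elim (ℕ.<⇒≢ 1≤m Σv≡m)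
  closed-form 1≤m (suc n) n<m = closed-form-step (closed-form 1≤m n (ℕ.<⇒≤ n<m)) n<m

lemma2p4 : ∀ {c ℓ} (R : CommutativeRing c ℓ) → NoZeroDivisors R →
           (m : ℕ) → 1 ≤ m →
           (ζ : CommutativeRing.Carrier R) → IsPrimitiveRoot R m ζ →
           (ν : Fin m → ℕ) → total ν ≡ m →
           CommutativeRing._≈_ R (u R m ζ ν)
             (CommutativeRing._*_ R
               (CommutativeRing._*_ R
                 (CommutativeRing._*_ R (natCast R m)
                   (pow R (CommutativeRing.-_ R (CommutativeRing.1# R)) (ell ν ∸ 1)))
                 (natCast R ((ell ν ∸ 1) !)))
               (natCast R ((m ∸ ell ν) !)))
lemma2p4 R noZeroDivisors m 1≤m ζ ζ-primitive ν total≡m = begin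
  u R m ζ ν                            ≈⟨ u≈F ν ⟩
  ζ ^ ℕ∑.sum ν * F m ν                 ≈⟨ *-cong ζ^Σν≈1 (closed-form 1≤m m ℕ.≤-refl ν Σν≡m) ⟩
  1# * Closed l (zeros ν)              ≈⟨ *-identityˡ _ ⟩
  A l * ι ((m ∸ l) ↓ zeros ν)          ≡⟨ ≡.cong (λ z → A l * ι ((m ∸ l) ↓ z)) zeros≡m-l ⟩
  A l * ι ((m ∸ l) ↓ (m ∸ l))          ≡⟨ ≡.cong (λ k → A l * ι k) (↓-self (m ∸ l)) ⟩
  A l * ι ((m ∸ l) !)                  ≡⟨ ≡.cong (λ k → A k * ι ((m ∸ k) !)) (ell≡positives ν) ⟨
  A (ell ν) * ι ((m ∸ ell ν) !)        ∎
  where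
  open CommutativeRing R
  open RingSums R
  open InjectionSums R m ζ
  open ClosedForm R noZeroDivisors m ζ ζ-primitive
  open import Relation.Binary.Reasoning.Setoid setoid
  l = positives ν
  Σν≡m : ℕ∑.sum ν ≡ m
  Σν≡m = ≡.trans (≡.sym (listSum-allFin ν)) total≡m
  ζ^Σν≈1 : ζ ^ ℕ∑.sum ν ≈ 1#
  ζ^Σν≈1 = trans (reflexive (≡.cong (ζ ^_) Σν≡m)) ζᵐ≈1
  zeros≡m-l : zeros ν ≡ m ∸ l
  zeros≡m-l = ≡.trans (≡.sym (ℕ.m+n∸m≡n l (zeros ν))) (≡.cong (_∸ l) (positives+zeros ν))
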